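{- Let $(\mathcal{C},\mathcal{K})$ be an island domain, let $\mathcal{H}\subseteq\mathcal{C}$ be an admissible family and let $h_{\mathcal{H}}$ be the canonical height function corresponding to $\mathcal{H}$. Then every member of $\mathcal{H}$ is a pre-island with respect to $(\mathcal{C},\mathcal{K},h_{\mathcal{H}})$.
   Context: An island domain is a pair $(\mathcal{C},\mathcal{K})$ where $U$ is a nonempty finite set and $\mathcal{C}\subseteq\mathcal{K}\subseteq\mathcal{P}(U)$ with $U\in\mathcal{C}$. A height function is any map $h\colon U\to\mathbb{R}$. Let $\prec$ denote the cover relation of the poset $(\mathcal{K},\subseteq)$. For a nonempty $S\in\mathcal{C}$, $S$ is a pre-island with respect to $(\mathcal{C},\mathcal{K},h)$ if every $K\in\mathcal{K}$ with $S\prec K$ satisfies $\min h(K)<\min h(S)$. A family $\mathcal{H}\subseteq\mathcal{C}\setminus\{\emptyset\}$ with $U\in\mathcal{H}$ is admissible if for every nonempty antichain $\mathcal{A}\subseteq\mathcal{H}$ there is $H\in\mathcal{A}$ such that for all $K\in\mathcal{K}$, $H\subsetneq K$ implies $K\not\subseteq\bigcup\mathcal{A}$. For an admissible $\mathcal{H}$, define subfamilies $\mathcal{H}^{(i)}$ recursively: $\mathcal{H}^{(0)}=\{U\}$; for $i>0$, as long as $\mathcal{R}_i:=\mathcal{H}\setminus(\mathcal{H}^{(0)}\cup\dots\cup\mathcal{H}^{(i-1)})$ is nonempty, let $\mathcal{H}^{(i)}$ consist of all $H\in\mathcal{R}_i$ such that for all $K\in\mathcal{K}$, $H\subsetneq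 K$ implies $K\not\subseteq\bigcup\mathcal{R}_i$. (By admissibility each such $\mathcal{H}^{(i)}$ is nonempty, so this yields a partition $\mathcal{H}=\mathcal{H}^{(0)}\cup\dots\cup\mathcal{H}^{(r)}$.) The canonical height function corresponding to $\mathcal{H}$ is $h_{\mathcal{H}}(x)=\max\{i\in\{0,1,\dots,r\}: x\in\bigcup\mathcal{H}^{(i)}\}$ for $x\in U$. -}

module Defs where

open import Level using (0ℓ)
open import Data.Nat using (ℕ; zero; suc; _≤_; _<_)
open import Data.Fin using (Fin)
open import Data.Fin.Subset using (Subset; _∈_; _⊆_; _⊂_; ⊤; Nonempty)
open import Data.Product using (Σ; ∃; _×_)
open import Data.Sum using (_⊎_)
open import Data.Empty using (⊥)
open import Relation.Nullary using (¬_)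
open import Relation.Unary using (Pred)
open import Relation.Binary.PropositionalEquality using (_≡_)

-- The base set U is Fin n; subsets of U are `Subset n`.
-- A family of subsets of U is a predicate on `Subset n`.
Family : ℕ → Set₁
Family n = Pred (Subset n) 0ℓ

module _ {n : ℕ} where

  InUnion : Family n → Fin n → Set
  InUnion F x = ∃ λ S → F S × x ∈ S

  -- 𝒞 ⊆ 𝒦 ⊆ P(U), U ∈ 𝒞 (U nonempty is imposed via n = suc m in the theorem)
  IsIslandDomain : Family n → Family n → Set
  IsIslandDomain 𝒞 𝒦 = (∀ S → 𝒞 S → 𝒦 S) × 𝒞 ⊤

  Covers : Family n → Subset n → Subset n → Set
  Covers 𝒦 S K = 𝒦 S × 𝒦 K × S ⊂ K × (∀ L → 𝒦 L → ¬ (S ⊂ L × L ⊂ K))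

  IsMinOn : (Fin n → ℕ) → Subset n → ℕ → Set
  IsMinOn h S m = (∃ λ x → x ∈ S × h x ≡ m) × (∀ x → x ∈ S → m ≤ h x)

  IsPreIsland : Family n → Family n → (Fin n → ℕ) → Subset n → Set
  IsPreIsland 𝒞 𝒦 h S =
    Nonempty S × 𝒞 S ×
    (∀ K → 𝒦 K → Covers 𝒦 S K →
      ∀ mK mS → IsMinOn h K mK → IsMinOn h S mS → mK < mS)

  IsAntichain : Family n → Set
  IsAntichain 𝒜 = ∀ A B → 𝒜 A → 𝒜 B → A ⊆ B → A ≡ B

  NoProperSuperIn : Family n → Family n → Subset n → Set
  NoProperSuperIn 𝒦 𝒜 H = ∀ K → 𝒦 K → H ⊂ K → ¬ (∀ x → x ∈ K → InUnion 𝒜 x)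

  IsAdmissible : Family n → Family n → Family n → Set₁
  IsAdmissible 𝒞 𝒦 ℋ =
    (∀ S → ℋ S → 𝒞 S × Nonempty S) × ℋ ⊤ ×
    (∀ (𝒜 : Family n) → (∀ A → 𝒜 A → ℋ A) → (∃ λ A → 𝒜 A) → IsAntichain 𝒜 →
      ∃ λ H → 𝒜 H × NoProperSuperIn 𝒦 𝒜 H)

  module _ (𝒦 ℋ : Family n) where
    mutual
      -- Below i S  :  S ∈ ℋ⁽⁰⁾ ∪ … ∪ ℋ⁽ⁱ⁻¹⁾
      Below : ℕ → Family n
      Below zero    S = ⊥
      Below (suc i) S = Below i S ⊎ Layer i S

      Layer : ℕ → Family n
      Layer zero    S = S ≡ ⊤
      Layer (suc i) S =
        Remaining (suc i) S × NoProperSuperIn 𝒦 (Remaining (suc i)) S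

      -- ℛᵢ = ℋ ∖ (ℋ⁽⁰⁾ ∪ … ∪ ℋ⁽ⁱ⁻¹⁾)
      Remaining : ℕ → Family n
      Remaining zero    S = ℋ S
      Remaining (suc i) S = ℋ S × ¬ (Below i S ⊎ Layer i S)

    IsCanonicalHeight : (Fin n → ℕ) → Set
    IsCanonicalHeight h =
      ∀ x → InUnion (Layer (h x)) x × (∀ i → InUnion (Layer i) x → i ≤ h x)

module Submission where

-- The layers ℋ⁽ⁱ⁾ are defined through negations, so membership of a
-- set in a layer is only available under double negation; since the
-- goal min h(K) < min h(S) is a decidable inequality of naturals, this
-- suffices.

open import Defs
open import Data.Nat using (ℕ; zero; suc; _≤_; _<_; _≤′_; ≤′-refl; ≤′-step; s≤s; _⊔_)
open import Data.Nat.Properties using (≤-trans; ≤-reflexive; <-irrefl; ≮⇒≥; _<?_; ≤⇒≤′; m≤m⊔n; m≤n⊔m)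
open import Data.Fin using (Fin)
import Data.Fin as Fin
open import Data.Fin.Subset using (Subset; _∈_; _⊆_; _⊂_; _⊃_)
open import Data.Fin.Subset.Properties using (∈⊤; _∈?_; ⊆-antisym)
open import Data.Fin.Subset.Induction using (⊃-wellFounded; Acc; acc)
open import Data.Product using (∃; _×_; _,_; proj₁; proj₂)
open import Data.Sum using (inj₁; inj₂)
open import Data.Empty using (⊥-elim)
open import Relation.Nullary using (¬_; yes; no)
open import Relation.Nullary.Decidable using (decidable-stable)
open import Relation.Binary.PropositionalEquality using (refl)

-- Double-negation shift over a finite domain: pointwise ¬¬ gives ¬¬ ∀.
-- Needed to transport a covering of a set through classical choices.
¬¬-∀-Fin : ∀ {n} {P : Fin n → Set} → (∀ x → ¬ ¬ P x) → ¬ ¬ (∀ x → P x)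
¬¬-∀-Fin {zero}      _   k = k (λ ())
¬¬-∀-Fin {suc n} {P} ¬¬P k =
  ¬¬P Fin.zero λ P0 →
  ¬¬-∀-Fin {P = λ x → P (Fin.suc x)} (λ x → ¬¬P (Fin.suc x)) λ P+ →
  k λ { Fin.zero → P0 ; (Fin.suc x) → P+ x }

-- A function on a finite set is bounded; used to see that heights,
-- hence nonempty layers, cannot go on forever.
bounded : ∀ {n} (h : Fin n → ℕ) → ∃ λ M → ∀ x → h x ≤ M
bounded {zero}  h = 0 , λ ()
bounded {suc n} h with bounded (λ x → h (Fin.suc x))
... | M , h+≤M = h Fin.zero ⊔ M , λ
  { Fin.zero    → m≤m⊔n (h Fin.zero) M
  ; (Fin.suc x) → ≤-trans (h+≤M x) (m≤n⊔m (h Fin.zero) M) }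

module _ {n : ℕ} where

  Maximal : Family n → Subset n → Set
  Maximal R A = R A × (∀ B → R B → ¬ (A ⊂ B))

  -- Every member of R lies below a maximal one (classically): a strictly
  -- increasing chain of subsets of Fin n must stop.
  maximal-above : (R : Family n) → ∀ {S} → R S →
                  ¬ ¬ (∃ λ A → Maximal R A × S ⊆ A)
  maximal-above R = climb (⊃-wellFounded _)
    where
    climb : ∀ {S} → Acc _⊃_ S → R S → ¬ ¬ (∃ λ A → Maximal R A × S ⊆ A)
    climb {S} (acc larger) rS noMax = noMax (S , (rS , S-maximal) , λ x∈S → x∈S)
      where
      S-maximal : ∀ B → R B → ¬ (S ⊂ B)
      S-maximal B rB S⊂B = climb (larger S⊂B) rB λ (A , maxA , B⊆A) →
        noMax (A , maxA , λ x∈S → B⊆A (proj₁ S⊂B x∈S))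

  -- Inclusion without proper inclusion is equality (membership is decidable).
  ⊆∧⊄⇒⊇ : ∀ {p q : Subset n} → p ⊆ q → ¬ (p ⊂ q) → q ⊆ p
  ⊆∧⊄⇒⊇ {p} p⊆q p⊄q {x} x∈q with x ∈? p
  ... | yes x∈p = x∈p
  ... | no  x∉p = ⊥-elim (p⊄q (p⊆q , x , x∈q , x∉p))

  maximals-antichain : (R : Family n) → IsAntichain (Maximal R)
  maximals-antichain R A B (_ , A-max) (rB , _) A⊆B =
    ⊆-antisym A⊆B (⊆∧⊄⇒⊇ A⊆B (A-max B rB))

  covered-by-maximals : (R : Family n) (K : Subset n) →
    (∀ x → x ∈ K → InUnion R x) → ¬ ¬ (∀ x → x ∈ K → InUnion (Maximal R) x)
  covered-by-maximals R K K⊆⋃R = ¬¬-∀-Fin λ x k → k λ x∈K →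
    let (T , rT , x∈T) = K⊆⋃R x x∈K
    in ⊥-elim (maximal-above R rT λ (A , maxA , T⊆A) → k λ _ → A , maxA , T⊆A x∈T)

  module _ {𝒦 ℋ : Family n} where

    remaining-step : ∀ {i T} → Remaining 𝒦 ℋ (suc i) T → Remaining 𝒦 ℋ i T
    remaining-step {zero}  (hT , _)        = hT
    remaining-step {suc i} (hT , unlisted) = hT , λ below → unlisted (inj₁ below)

    remaining-antitone : ∀ {i j T} → j ≤′ i → Remaining 𝒦 ℋ i T → Remaining 𝒦 ℋ j T
    remaining-antitone ≤′-refl        r = r
    remaining-antitone (≤′-step j≤′i) r = remaining-antitone j≤′i (remaining-step r)

    layer⊆remaining : ∀ {i j T} → suc j ≤ i → Layer 𝒦 ℋ i T → Remaining 𝒦 ℋ (suc j) T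
    layer⊆remaining {suc i} j<i (rT , _) = remaining-antitone (≤⇒≤′ j<i) rT

    below⇒layer : ∀ {i S} → Below 𝒦 ℋ i S → ∃ λ j → Layer 𝒦 ℋ j S
    below⇒layer {suc i} (inj₁ below) = below⇒layer below
    below⇒layer {suc i} (inj₂ layer) = i , layer

    unlayered⇒remaining : ∀ {S} → ℋ S → ¬ (∃ λ j → Layer 𝒦 ℋ j S) →
                          ∀ i → Remaining 𝒦 ℋ i S
    unlayered⇒remaining hS _        zero    = hS
    unlayered⇒remaining hS unlayered (suc i) = hS , λ
      { (inj₁ below) → unlayered (below⇒layer below)
      ; (inj₂ layer) → unlayered (i , layer) }

    layer≤minimum : ∀ {h i S mS} → IsCanonicalHeight 𝒦 ℋ h →
                    Layer 𝒦 ℋ i S → IsMinOn h S mS → i ≤ mS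
    layer≤minimum {S = S} can layer ((y , y∈S , hy≡mS) , _) =
      ≤-trans (proj₂ (can y) _ (S , layer , y∈S)) (≤-reflexive hy≡mS)

    -- Otherwise every point of K lies in a member of
    -- the layer of its height ≥ i, so K ⊆ ⋃ ℛᵢ, which ℋ⁽ⁱ⁾ forbids.
    proper-superset-dips : ∀ {h i S K} → IsCanonicalHeight 𝒦 ℋ h →
      Layer 𝒦 ℋ i S → 𝒦 K → S ⊂ K → ¬ (∀ x → x ∈ K → i ≤ h x)
    proper-superset-dips {i = zero}  _   refl _ (_ , x , _ , x∉⊤) _ = x∉⊤ ∈⊤
    proper-superset-dips {i = suc j} can (_ , no-superset) kK S⊂K high =
      no-superset _ kK S⊂K λ x x∈K →
        let (T , layerT , x∈T) = proj₁ (can x)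
        in T , layer⊆remaining (high x x∈K) layerT , x∈T

  module _ {𝒞 𝒦 ℋ : Family n} (adm : IsAdmissible 𝒞 𝒦 ℋ) where

    -- While ℛᵢ₊₁ is nonempty, so is the layer ℋ⁽ⁱ⁺¹⁾: admissibility applied
    -- to the antichain of maximal members of ℛᵢ₊₁ yields a member H with no
    -- proper 𝒦-superset covered by them, hence none covered by ℛᵢ₊₁.
    layer-nonempty : ∀ i {T} → Remaining 𝒦 ℋ (suc i) T →
                     ¬ ¬ (∃ λ H → Layer 𝒦 ℋ (suc i) H)
    layer-nonempty i rT k = maximal-above ℛ rT λ (A , maxA , _) →
      let (H , (rH , _) , no-superset) =
            proj₂ (proj₂ adm) (Maximal ℛ) (λ B maxB → proj₁ (proj₁ maxB))
                              (A , maxA) (maximals-antichain ℛ)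
      in k (H , rH , λ K kK H⊂K K⊆⋃ℛ →
             covered-by-maximals ℛ K K⊆⋃ℛ (no-superset K kK H⊂K))
      where
      ℛ : Family n
      ℛ = Remaining 𝒦 ℋ (suc i)

    -- Every member of ℋ lies in some layer: otherwise it remains in ℛ_{M+1}
    -- for a bound M of h, so ℋ⁽ᴹ⁺¹⁾ has a (nonempty) member, whose points
    -- would have height M + 1 > M.
    member-in-layer : ∀ {h} → IsCanonicalHeight 𝒦 ℋ h →
                      ∀ {S} → ℋ S → ¬ ¬ (∃ λ i → Layer 𝒦 ℋ i S)
    member-in-layer {h} can hS unlayered =
      layer-nonempty M (unlayered⇒remaining hS unlayered (suc M)) λ (H , layerH) →
        let (x , x∈H) = proj₂ (proj₁ adm H (proj₁ (proj₁ layerH)))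
        in <-irrefl refl (≤-trans (s≤s (h≤M x)) (proj₂ (can x) (suc M) (H , layerH , x∈H)))
      where
      M : ℕ
      M = proj₁ (bounded h)
      h≤M : ∀ x → h x ≤ M
      h≤M = proj₂ (bounded h)

proposition3p6 :
    (m : ℕ) (𝒞 𝒦 ℋ : Family (suc m)) →
    IsIslandDomain 𝒞 𝒦 →
    IsAdmissible 𝒞 𝒦 ℋ →
    (h : Fin (suc m) → ℕ) → IsCanonicalHeight 𝒦 ℋ h →
    ∀ S → ℋ S → IsPreIsland 𝒞 𝒦 h S
proposition3p6 m 𝒞 𝒦 ℋ _ adm h can S hS =
  proj₂ (proj₁ adm S hS) , proj₁ (proj₁ adm S hS) , minimum-drops
  where
  minimum-drops : ∀ K → 𝒦 K → Covers 𝒦 S K →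
                  ∀ mK mS → IsMinOn h K mK → IsMinOn h S mS → mK < mS
  minimum-drops K kK (_ , _ , S⊂K , _) mK mS minK minS =
    decidable-stable (mK <? mS) λ mK≮mS →
    member-in-layer adm can hS λ (i , layerS) →
    proper-superset-dips can layerS kK S⊂K λ x x∈K →
      ≤-trans (layer≤minimum can layerS minS)
              (≤-trans (≮⇒≥ mK≮mS) (proj₂ minK x x∈K))
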